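{- Let $n$ be a positive integer. For all integers $1\le k,j\le n$, \[ \#\{\pi\in W_{n,k} : Q_n(\pi)=j\}=\#\{\pi\in W_{n,n+1-k} : Q_n(\pi)=n+1-j\}. \]
   Context: For a permutation $\pi=p_1p_2\ldots p_n$ of $[n]=\{1,\dots,n\}$ (one-line notation), an index $i$ is a weak excedance if $p_i\ge i$. $W_{n,m}$ is the set of permutations of $[n]$ with exactly $m$ weak excedances. $Q_n(\pi)$ is the index $i$ such that $p_i=n$. -}

module Defs where

open import Data.Nat using (ℕ; suc; _+_; _∸_; _≤_)
open import Data.Nat.Properties using (_≤?_; _≟_)
open import Data.Fin using (Fin; toℕ)
open import Data.Fin.Properties using () renaming (_≟_ to _≟ᶠ_)
open import Data.Vec using (Vec; []; _∷_; lookup; toList)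
open import Data.List using (List; []; _∷_; length; filter; allFin; concatMap; map)
open import Data.List.Relation.Unary.Unique.Propositional using (Unique)
import Data.List.Relation.Unary.Unique.DecPropositional as UDec
open import Data.Product using (_×_)
open import Relation.Nullary.Decidable using (Dec; _×-dec_)
open import Data.List.Relation.Unary.Any using (Any; any?)
open import Relation.Binary.PropositionalEquality using (_≡_)

-- A permutation of [n] in one-line notation p_1 … p_n is represented
-- 0-based as a vector w : Vec (Fin n) n with pairwise distinct entries;
-- p_i = toℕ (lookup w (i-1)) + 1.

words : (n m : ℕ) → List (Vec (Fin n) m)
words n ℕ.zero = [] ∷ []
words n (suc m) = concatMap (λ x → map (x ∷_) (words n m)) (allFin n)

IsPerm : ∀ {n} → Vec (Fin n) n → Set
IsPerm w = Unique (toList w)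

perms : (n : ℕ) → List (Vec (Fin n) n)
perms n = filter (λ w → UDec.unique? (_≟ᶠ_ {n}) (toList w)) (words n n)

wex : ∀ {n} → Vec (Fin n) n → ℕ
wex {n} w = length (filter (λ i → toℕ i ≤? toℕ (lookup w i)) (allFin n))

-- Q_n(π) = j  iff  p_j = n  (1-based): some 0-based index i with i+1 = j and p = n
Qdec : ∀ {n} (w : Vec (Fin n) n) (j : ℕ) → Dec (Any (λ i → (toℕ i + 1 ≡ j) × (toℕ (lookup w i) + 1 ≡ n)) (allFin n))
Qdec {n} w j = any? (λ i → ((toℕ i + 1) ≟ j) ×-dec ((toℕ (lookup w i) + 1) ≟ n)) (allFin n)

countWQ : (n k j : ℕ) → ℕ
countWQ n k j = length (filter (λ w → (wex w ≟ k) ×-dec Qdec w j) (perms n))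

module Submission where

-- Write N = n + 1.  For a permutation π of [N] let π* be its
-- "dual": π*(i) = c(π(N+1-i)), where c fixes the largest value N and maps
-- every other value v to N - v (the complement inside {1, …, N-1}).  Then
--   * π ↦ π* is an involution on the set of permutations;
--   * Q(π*) = N+1 - Q(π), because c fixes N and i ↦ N+1-i reverses positions;
--   * wex(π*) + wex(π) = N + 1: comparing index i of π with index N+1-i of π*,
--     exactly one of the two is a weak excedance, except at the position of N
--     where both are.
-- Hence π ↦ π* maps {π ∈ W_{N,k} : Q(π) = j} bijectively onto
-- {π ∈ W_{N,N+1-k} : Q(π) = N+1-j}.

open import Defs
open import Data.Nat using (ℕ; zero; suc; _+_; _∸_; _≤_; _<_; _≤?_)
open import Data.Nat.Properties
  using (_≟_; suc-injective; +-comm; +-suc; +-commutativeSemigroup; m+n∸m≡n; m+n∸n≡m; m∸[m∸n]≡n; m+[n∸m]≡n; ≤-trans; m≤m+n; ∸-monoʳ-≤; ∸-cancelʳ-≤; ≰⇒>; <⇒≱)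
open import Algebra.Properties.CommutativeSemigroup +-commutativeSemigroup using (interchange)
open import Data.Fin using (Fin; zero; suc; toℕ; fromℕ; inject₁; opposite)
open import Data.Fin.Properties
  using (toℕ-fromℕ; toℕ-inject₁; toℕ-injective; toℕ<n; toℕ≤pred[n]; opposite-prop;
         opposite-involutive; fromℕ≢inject₁)
  renaming (_≟_ to _≟ᶠ_)
open import Data.Fin.Relation.Unary.Top using (View; view; ‵fromℕ; ‵inject₁; view-fromℕ; view-inject₁)
open import Data.Vec using (Vec; []; _∷_; lookup; toList; tabulate)
open import Data.Vec.Properties using (lookup∘tabulate; tabulate∘lookup; tabulate-cong; ∷-injective)
open import Data.List as List using (List; []; _∷_; [_]; length; filter; map; _++_; allFin; concatMap; cartesianProductWith)
open import Data.List.Properties using (length-tabulate)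
open import Data.List.Relation.Unary.All using ([])
import Data.List.Relation.Unary.All.Properties as All
open import Data.List.Relation.Unary.Any using (Any; here; there)
import Data.List.Relation.Unary.Any.Properties as Any
open import Data.List.Relation.Unary.AllPairs using ([]; _∷_)
open import Data.List.Relation.Unary.Unique.Propositional using (Unique)
import Data.List.Relation.Unary.Unique.Propositional.Properties as Unique
import Data.List.Relation.Unary.Unique.DecPropositional as UniqueDec
open import Data.List.Membership.Propositional using (_∈_)
open import Data.List.Membership.Propositional.Properties
  using (∈-map⁺; ∈-map⁻; ∈-filter⁺; ∈-filter⁻; ∈-allFin; ∈-cartesianProductWith⁺)
open import Data.List.Membership.Propositional.Properties.WithK using (unique∧set⇒bag)
open import Data.List.Relation.Binary.BagAndSetEquality using (∼bag⇒↭)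
open import Data.List.Relation.Binary.Permutation.Propositional using (_↭_; ↭-sym)
open import Data.List.Relation.Binary.Permutation.Propositional.Properties using (↭-length; filter-↭)
open import Data.Product using (∃; _×_; _,_; proj₂)
open import Function using (_∘_; _⇔_; mk⇔; Equivalence)
open import Function.Definitions using (Injective)
open import Level using (Level)
open import Relation.Nullary using (Dec; yes; no; ¬_; contradiction)
open import Relation.Nullary.Decidable using (_×-dec_)
open import Relation.Unary using (Pred; Decidable)
open import Relation.Binary.PropositionalEquality
  using (_≡_; refl; sym; trans; cong; cong₂; subst; module ≡-Reasoning)

open Equivalence using (to; from)

private
  variable
    a p q r : Level
    A B : Set a
    m : ℕ

𝟙[_] : {P : Set p} → Dec P → ℕ
𝟙[ yes _ ] = 1
𝟙[ no _ ]  = 0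

𝟙-yes : {P : Set p} (P? : Dec P) → P → 𝟙[ P? ] ≡ 1
𝟙-yes (yes _)  _ = refl
𝟙-yes (no ¬p) p  = contradiction p ¬p

𝟙-no : {P : Set p} (P? : Dec P) → ¬ P → 𝟙[ P? ] ≡ 0
𝟙-no (yes p) ¬p = contradiction p ¬p
𝟙-no (no _)  _  = refl

𝟙-cong : {P : Set p} {Q : Set q} (P? : Dec P) (Q? : Dec Q) → P ⇔ Q → 𝟙[ P? ] ≡ 𝟙[ Q? ]
𝟙-cong (yes _) (yes _) _   = refl
𝟙-cong (no _)  (no _)  _   = refl
𝟙-cong (yes p) (no ¬q) P⇔Q = contradiction (to P⇔Q p) ¬q
𝟙-cong (no ¬p) (yes q) P⇔Q = contradiction (from P⇔Q q) ¬p

𝟙-exclusive : {P : Set p} {Q : Set q} (P? : Dec P) (Q? : Dec Q) →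
  (P → ¬ Q) → (¬ Q → P) → 𝟙[ P? ] + 𝟙[ Q? ] ≡ 1
𝟙-exclusive (yes p) (yes q) P⇒¬Q _ = contradiction q (P⇒¬Q p)
𝟙-exclusive (yes _) (no _)  _ _ = refl
𝟙-exclusive (no _)  (yes _) _ _ = refl
𝟙-exclusive (no ¬p) (no ¬q) _ ¬Q⇒P = contradiction (¬Q⇒P ¬q) ¬p

count : {P : Pred A p} → Decidable P → List A → ℕ
count P? xs = length (filter P? xs)

count-∷ : {P : Pred A p} (P? : Decidable P) (x : A) (xs : List A) →
  count P? (x ∷ xs) ≡ 𝟙[ P? x ] + count P? xs
count-∷ P? x xs with P? x
... | yes _ = refl
... | no _  = refl

count-map : {P : Pred A p} (P? : Decidable P) (f : B → A) (xs : List B) →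
  count P? (map f xs) ≡ count (P? ∘ f) xs
count-map P? f []       = refl
count-map P? f (x ∷ xs) with P? (f x)
... | yes _ = cong suc (count-map P? f xs)
... | no _  = count-map P? f xs

count-cong : {P : Pred A p} {Q : Pred A q} (P? : Decidable P) (Q? : Decidable Q) {xs : List A} →
  (∀ {x} → x ∈ xs → P x ⇔ Q x) → count P? xs ≡ count Q? xs
count-cong P? Q? {[]}     _   = refl
count-cong P? Q? {x ∷ xs} P⇔Q = begin
  count P? (x ∷ xs)        ≡⟨ count-∷ P? x xs ⟩
  𝟙[ P? x ] + count P? xs  ≡⟨ cong₂ _+_ (𝟙-cong (P? x) (Q? x) (P⇔Q (here refl)))
                                        (count-cong P? Q? (P⇔Q ∘ there)) ⟩
  𝟙[ Q? x ] + count Q? xs  ≡⟨ sym (count-∷ Q? x xs) ⟩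
  count Q? (x ∷ xs)        ∎
  where open ≡-Reasoning

count-+ : {P : Pred A p} {Q : Pred A q} {R : Pred A r}
  (P? : Decidable P) (Q? : Decidable Q) (R? : Decidable R) →
  (∀ x → 𝟙[ P? x ] + 𝟙[ Q? x ] ≡ 1 + 𝟙[ R? x ]) →
  ∀ xs → count P? xs + count Q? xs ≡ length xs + count R? xs
count-+ P? Q? R? brackets []       = refl
count-+ P? Q? R? brackets (x ∷ xs) = begin
  count P? (x ∷ xs) + count Q? (x ∷ xs)
    ≡⟨ cong₂ _+_ (count-∷ P? x xs) (count-∷ Q? x xs) ⟩
  (𝟙[ P? x ] + count P? xs) + (𝟙[ Q? x ] + count Q? xs)
    ≡⟨ interchange 𝟙[ P? x ] (count P? xs) 𝟙[ Q? x ] (count Q? xs) ⟩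
  (𝟙[ P? x ] + 𝟙[ Q? x ]) + (count P? xs + count Q? xs)
    ≡⟨ cong₂ _+_ (brackets x) (count-+ P? Q? R? brackets xs) ⟩
  (1 + 𝟙[ R? x ]) + (length xs + count R? xs)
    ≡⟨ interchange 1 𝟙[ R? x ] (length xs) (count R? xs) ⟩
  suc (length xs) + (𝟙[ R? x ] + count R? xs)
    ≡⟨ cong (suc (length xs) +_) (sym (count-∷ R? x xs)) ⟩
  length (x ∷ xs) + count R? (x ∷ xs) ∎
  where open ≡-Reasoning

unique-set⇒↭ : {xs ys : List A} → Unique xs → Unique ys → (∀ {x} → x ∈ xs ⇔ x ∈ ys) → xs ↭ ys
unique-set⇒↭ uxs uys same = ∼bag⇒↭ (unique∧set⇒bag uxs uys same)

involution⇒injective : {f : A → A} → (∀ x → f (f x) ≡ x) → Injective _≡_ _≡_ f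
involution⇒injective {f = f} inv {x} {y} fx≡fy =
  trans (sym (inv x)) (trans (cong f fx≡fy) (inv y))

-- An involution mapping a duplicate-free list into itself permutes it, so
-- counting P along the list is the same as counting P ∘ f.
count-involution : {P : Pred A p} (P? : Decidable P) (f : A → A) {xs : List A} →
  Unique xs → (∀ x → f (f x) ≡ x) → (∀ {x} → x ∈ xs → f x ∈ xs) →
  count P? xs ≡ count (P? ∘ f) xs
count-involution P? f {xs} uxs inv closed = begin
  count P? xs          ≡⟨ ↭-length (filter-↭ P? (↭-sym fxs↭xs)) ⟩
  count P? (map f xs)  ≡⟨ count-map P? f xs ⟩
  count (P? ∘ f) xs    ∎
  where
  open ≡-Reasoning
  fxs↭xs : map f xs ↭ xs
  fxs↭xs = unique-set⇒↭ (Unique.map⁺ (involution⇒injective inv) uxs) uxs (mk⇔ into onto)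
    where
    into : ∀ {y} → y ∈ map f xs → y ∈ xs
    into y∈ with x , x∈xs , refl ← ∈-map⁻ f y∈ = closed x∈xs
    onto : ∀ {y} → y ∈ xs → y ∈ map f xs
    onto {y} y∈xs = subst (_∈ map f xs) (inv y) (∈-map⁺ f (closed y∈xs))

count-≡1 : {P : Pred A p} (P? : Decidable P) {xs : List A} {x : A} →
  Unique xs → x ∈ xs → P x → (∀ {y} → P y → y ≡ x) → count P? xs ≡ 1
count-≡1 P? {xs} {x} uxs x∈xs px only =
  ↭-length (unique-set⇒↭ (Unique.filter⁺ P? uxs) ([] ∷ []) (mk⇔ into onto))
  where
  into : ∀ {y} → y ∈ filter P? xs → y ∈ [ x ]
  into y∈ = here (only (proj₂ (∈-filter⁻ P? {xs = xs} y∈)))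
  onto : ∀ {y} → y ∈ [ x ] → y ∈ filter P? xs
  onto (here refl) = ∈-filter⁺ P? x∈xs px

sum-split : ∀ {x y s k} → x + y ≡ s → k ≤ s → x ≡ k ⇔ y ≡ s ∸ k
sum-split {x} {y} refl k≤s = mk⇔
  (λ { refl → sym (m+n∸m≡n x y) })
  (λ { y≡ → trans (sym (m+n∸n≡m x y)) (trans (cong (x + y ∸_) y≡) (m∸[m∸n]≡n k≤s)) })

toList≡tabulate : (v : Vec A m) → toList v ≡ List.tabulate (lookup v)
toList≡tabulate []      = refl
toList≡tabulate (x ∷ v) = cong (x ∷_) (toList≡tabulate v)

tabulate⁻ : {f : Fin m → A} → Unique (List.tabulate f) → Injective _≡_ _≡_ f
tabulate⁻ {m = suc _} _          {zero}  {zero}  _  = refl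
tabulate⁻ {m = suc _} (f₀∉ ∷ _)  {zero}  {suc j} eq = contradiction eq (All.tabulate⁻ f₀∉ j)
tabulate⁻ {m = suc _} (f₀∉ ∷ _)  {suc i} {zero}  eq = contradiction (sym eq) (All.tabulate⁻ f₀∉ i)
tabulate⁻ {m = suc _} (_ ∷ uniq) {suc i} {suc j} eq = cong suc (tabulate⁻ uniq eq)

IsPerm⇔injective : {n : ℕ} {w : Vec (Fin n) n} → IsPerm w ⇔ Injective _≡_ _≡_ (lookup w)
IsPerm⇔injective {w = w} = mk⇔
  (tabulate⁻ ∘ subst Unique (toList≡tabulate w))
  (subst Unique (sym (toList≡tabulate w)) ∘ Unique.tabulate⁺)

concatMap≡cartesianProductWith : {C : Set a} (f : A → B → C) (xs : List A) (ys : List B) →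
  concatMap (λ x → map (f x) ys) xs ≡ cartesianProductWith f xs ys
concatMap≡cartesianProductWith f []       ys = refl
concatMap≡cartesianProductWith f (x ∷ xs) ys = cong (map (f x) ys ++_) (concatMap≡cartesianProductWith f xs ys)

words-unique : ∀ n m → Unique (words n m)
words-unique n zero    = [] ∷ []
words-unique n (suc m) = subst Unique (sym (concatMap≡cartesianProductWith _∷_ (allFin n) (words n m)))
  (Unique.cartesianProductWith⁺ _∷_ ∷-injective (Unique.allFin⁺ n) (words-unique n m))

words-complete : ∀ {n m} (v : Vec (Fin n) m) → v ∈ words n m
words-complete {n} {zero}  []      = here refl
words-complete {n} {suc m} (x ∷ v) = subst (x ∷ v ∈_) (sym (concatMap≡cartesianProductWith _∷_ (allFin n) (words n m)))
  (∈-cartesianProductWith⁺ _∷_ (∈-allFin x) (words-complete v))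

isPerm? : ∀ {n} (w : Vec (Fin n) n) → Dec (IsPerm w)
isPerm? w = UniqueDec.unique? _≟ᶠ_ (toList w)

perms-unique : ∀ n → Unique (perms n)
perms-unique n = Unique.filter⁺ isPerm? (words-unique n n)

∈-perms : ∀ {n} (w : Vec (Fin n) n) → w ∈ perms n ⇔ IsPerm w
∈-perms {n} w = mk⇔
  (proj₂ ∘ ∈-filter⁻ isPerm? {xs = words n n})
  (∈-filter⁺ isPerm? (words-complete w))

MaxAt : ∀ {n} → Vec (Fin n) n → ℕ → Set
MaxAt {n} w j = Any (λ i → (toℕ i + 1 ≡ j) × (toℕ (lookup w i) + 1 ≡ n)) (allFin n)

∸-≤-exclusive : ∀ {n m v} → v < n → 𝟙[ n ∸ m ≤? n ∸ suc v ] + 𝟙[ m ≤? v ] ≡ 1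
∸-≤-exclusive {n} {m} {v} v<n = 𝟙-exclusive (n ∸ m ≤? n ∸ suc v) (m ≤? v)
  (λ n∸m≤ → <⇒≱ (∸-cancelʳ-≤ v<n n∸m≤))
  (λ m≰v → ∸-monoʳ-≤ n (≰⇒> m≰v))

-- Permutations here are of [n + 1], written 0-based
-- as words over Fin (suc n); so "n + 2" below is N + 1 in the notation above,
-- and the largest value N is  top = n  (0-based).
module Dual (n : ℕ) where

  top : Fin (suc n)
  top = fromℕ n

  complement : Fin (suc n) → Fin (suc n)
  complement x with view x
  ... | ‵fromℕ     = top
  ... | ‵inject₁ y = inject₁ (opposite y)

  complement-top : complement top ≡ top
  complement-top rewrite view-fromℕ n = refl

  complement-inject₁ : (y : Fin n) → complement (inject₁ y) ≡ inject₁ (opposite y)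
  complement-inject₁ y rewrite view-inject₁ y = refl

  -- Proofs by cases on x use the view as an argument, so that the goal keeps
  -- mentioning complement x rather than its unfolding.
  complement-involutive : ∀ x → complement (complement x) ≡ x
  complement-involutive x = by-cases (view x)
    where
    by-cases : ∀ {x} → View x → complement (complement x) ≡ x
    by-cases ‵fromℕ       = trans (cong complement complement-top) complement-top
    by-cases (‵inject₁ y) = begin
      complement (complement (inject₁ y))  ≡⟨ cong complement (complement-inject₁ y) ⟩
      complement (inject₁ (opposite y))    ≡⟨ complement-inject₁ (opposite y) ⟩
      inject₁ (opposite (opposite y))      ≡⟨ cong inject₁ (opposite-involutive y) ⟩
      inject₁ y                            ∎
      where open ≡-Reasoning

  complement-top⇔ : ∀ {x} → complement x ≡ top ⇔ x ≡ top
  complement-top⇔ {x} = mk⇔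
    (λ cx≡top → trans (sym (complement-involutive x)) (trans (cong complement cx≡top) complement-top))
    (λ { refl → complement-top })

  -- The pointwise form of  wex(π*) + wex(π) = n + 2:  for a value v at
  -- position i of π, the value c v sits at the opposite position of π*; both
  -- positions are weak excedances if v is the top value, exactly one otherwise.
  excedance-dual : (i v : Fin (suc n)) →
    𝟙[ toℕ (opposite i) ≤? toℕ (complement v) ] + 𝟙[ toℕ i ≤? toℕ v ] ≡ 1 + 𝟙[ v ≟ᶠ top ]
  excedance-dual i v = by-cases (view v)
    where
    by-cases : ∀ {v} → View v →
      𝟙[ toℕ (opposite i) ≤? toℕ (complement v) ] + 𝟙[ toℕ i ≤? toℕ v ] ≡ 1 + 𝟙[ v ≟ᶠ top ]
    by-cases ‵fromℕ
      rewrite complement-top | toℕ-fromℕ n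
            | 𝟙-yes (toℕ (opposite i) ≤? n) (toℕ≤pred[n] (opposite i))
            | 𝟙-yes (toℕ i ≤? n) (toℕ≤pred[n] i)
            | 𝟙-yes (top ≟ᶠ top) refl
            = refl
    by-cases (‵inject₁ y)
      rewrite complement-inject₁ y | toℕ-inject₁ (opposite y) | opposite-prop y
            | opposite-prop i | toℕ-inject₁ y
            | 𝟙-no (inject₁ y ≟ᶠ top) (fromℕ≢inject₁ ∘ sym)
            = ∸-≤-exclusive {m = toℕ i} (toℕ<n y)

  Word : Set
  Word = Vec (Fin (suc n)) (suc n)

  dual : Word → Word
  dual w = tabulate (λ i → complement (lookup w (opposite i)))

  lookup-dual : ∀ w i → lookup (dual w) i ≡ complement (lookup w (opposite i))
  lookup-dual w = lookup∘tabulate (λ i → complement (lookup w (opposite i)))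

  lookup-dual-opposite : ∀ w i → lookup (dual w) (opposite i) ≡ complement (lookup w i)
  lookup-dual-opposite w i =
    trans (lookup-dual w (opposite i)) (cong (complement ∘ lookup w) (opposite-involutive i))

  dual-involutive : ∀ w → dual (dual w) ≡ w
  dual-involutive w = begin
    dual (dual w)          ≡⟨ tabulate-cong complement-twice ⟩
    tabulate (lookup w)    ≡⟨ tabulate∘lookup w ⟩
    w                      ∎
    where
    open ≡-Reasoning
    complement-twice : ∀ i → complement (lookup (dual w) (opposite i)) ≡ lookup w i
    complement-twice i = trans (cong complement (lookup-dual-opposite w i)) (complement-involutive _)

  opposite-injective : Injective _≡_ _≡_ (opposite {suc n})
  opposite-injective = involution⇒injective opposite-involutive

  complement-injective : Injective _≡_ _≡_ complement
  complement-injective = involution⇒injective complement-involutive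

  dual-perm : ∀ {w} → IsPerm w → IsPerm (dual w)
  dual-perm {w} perm = from (IsPerm⇔injective {w = dual w}) λ {i} {j} eq →
    opposite-injective
      (to (IsPerm⇔injective {w = w}) perm
        (complement-injective
          (trans (sym (lookup-dual w i)) (trans eq (lookup-dual w j)))))

  dual-∈-perms : ∀ {w} → w ∈ perms (suc n) → dual w ∈ perms (suc n)
  dual-∈-perms {w} = from (∈-perms (dual w)) ∘ dual-perm ∘ to (∈-perms w)

  max-value⇔ : ∀ (x : Fin (suc n)) → toℕ x + 1 ≡ suc n ⇔ x ≡ top
  max-value⇔ x = mk⇔
    (λ eq → toℕ-injective (trans (suc-injective (trans (+-comm 1 (toℕ x)) eq)) (sym (toℕ-fromℕ n))))
    (λ { refl → trans (+-comm (toℕ top) 1) (cong suc (toℕ-fromℕ n)) })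

  MaxAt⇔ : ∀ w {j} → MaxAt w j ⇔ ∃ λ i → toℕ i + 1 ≡ j × lookup w i ≡ top
  MaxAt⇔ w {j} = mk⇔ witness (λ { (i , pos , max) → Any.tabulate⁺ {f = λ i → i} i (pos , from (max-value⇔ (lookup w i)) max) })
    where
    witness : MaxAt w j → ∃ λ i → toℕ i + 1 ≡ j × lookup w i ≡ top
    witness q with i , pos , max ← Any.tabulate⁻ q = i , pos , to (max-value⇔ (lookup w i)) max

  position-opposite : ∀ (i : Fin (suc n)) → (toℕ i + 1) + (toℕ (opposite i) + 1) ≡ suc n + 1
  position-opposite i = begin
    (toℕ i + 1) + (toℕ (opposite i) + 1)  ≡⟨ interchange (toℕ i) 1 (toℕ (opposite i)) 1 ⟩
    (toℕ i + toℕ (opposite i)) + 2        ≡⟨ cong (λ o → toℕ i + o + 2) (opposite-prop i) ⟩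
    (toℕ i + (n ∸ toℕ i)) + 2             ≡⟨ cong (_+ 2) (m+[n∸m]≡n (toℕ≤pred[n] i)) ⟩
    n + 2                                 ≡⟨ +-suc n 1 ⟩
    suc n + 1                             ∎
    where open ≡-Reasoning

  MaxAt-dual : ∀ {w j} → j ≤ suc n + 1 → MaxAt (dual w) j ⇔ MaxAt w (suc n + 1 ∸ j)
  MaxAt-dual {w} {j} j≤ = mk⇔
    (λ q → let i , pos , max = to (MaxAt⇔ (dual w)) q in from (MaxAt⇔ w)
      ( opposite i
      , to (sum-split (position-opposite i) j≤) pos
      , to complement-top⇔ (trans (sym (lookup-dual w i)) max)))
    (λ q → let i , pos , max = to (MaxAt⇔ w) q in from (MaxAt⇔ (dual w))
      ( opposite i
      , from (sum-split (trans (+-comm (toℕ (opposite i) + 1) (toℕ i + 1)) (position-opposite i)) j≤) pos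
      , trans (lookup-dual-opposite w i) (from complement-top⇔ max)))

  -- Reindexing wex(π*) along i ↦ opposite i turns it into a count over the
  -- positions of π, which is summed with wex(π) by excedance-dual.
  wex-dual : ∀ {w} → IsPerm w → ∀ i₀ → lookup w i₀ ≡ top → wex (dual w) + wex w ≡ suc n + 1
  wex-dual {w} perm i₀ max₀ = begin
    wex (dual w) + wex w
      ≡⟨ cong (_+ wex w) reindex ⟩
    count excedanceᵒ positions + count excedance positions
      ≡⟨ count-+ excedanceᵒ excedance isMax (λ i → excedance-dual i (lookup w i)) positions ⟩
    length positions + count isMax positions
      ≡⟨ cong₂ _+_ (length-tabulate (λ i → i)) (count-≡1 isMax (Unique.allFin⁺ (suc n)) (∈-allFin i₀) max₀ only) ⟩
    suc n + 1
      ∎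
    where
    open ≡-Reasoning
    positions : List (Fin (suc n))
    positions = allFin (suc n)
    excedance : (i : Fin (suc n)) → Dec (toℕ i ≤ toℕ (lookup w i))
    excedance i = toℕ i ≤? toℕ (lookup w i)
    excedanceᵒ : (i : Fin (suc n)) → Dec (toℕ (opposite i) ≤ toℕ (complement (lookup w i)))
    excedanceᵒ i = toℕ (opposite i) ≤? toℕ (complement (lookup w i))
    excedanceᵈ : (i : Fin (suc n)) → Dec (toℕ i ≤ toℕ (lookup (dual w) i))
    excedanceᵈ i = toℕ i ≤? toℕ (lookup (dual w) i)
    isMax : (i : Fin (suc n)) → Dec (lookup w i ≡ top)
    isMax i = lookup w i ≟ᶠ top
    only : ∀ {i} → lookup w i ≡ top → i ≡ i₀
    only max = to (IsPerm⇔injective {w = w}) perm (trans max (sym max₀))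
    reindex : wex (dual w) ≡ count excedanceᵒ positions
    reindex = trans
      (count-involution excedanceᵈ opposite (Unique.allFin⁺ (suc n)) opposite-involutive (λ _ → ∈-allFin _))
      (count-cong (excedanceᵈ ∘ opposite) excedanceᵒ {positions} λ {i} _ →
        let ≤value = λ v → toℕ (opposite i) ≤ toℕ v
            same = lookup-dual-opposite w i
        in mk⇔ (subst ≤value same) (subst ≤value (sym same)))

  dual-WQ : ∀ {w k j} → IsPerm w → k ≤ suc n + 1 → j ≤ suc n + 1 →
    (wex (dual w) ≡ k × MaxAt (dual w) j) ⇔ (wex w ≡ suc n + 1 ∸ k × MaxAt w (suc n + 1 ∸ j))
  dual-WQ {w} {k} {j} perm k≤ j≤ = mk⇔
    (λ { (wex≡ , q) → let q′ = to (MaxAt-dual {w} j≤) q in to (wex-split q′) wex≡ , q′ })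
    (λ { (wex≡ , q′) → from (wex-split q′) wex≡ , from (MaxAt-dual {w} j≤) q′ })
    where
    wex-split : ∀ {j′} → MaxAt w j′ → wex (dual w) ≡ k ⇔ wex w ≡ suc n + 1 ∸ k
    wex-split q with i₀ , _ , max₀ ← to (MaxAt⇔ w) q = sum-split (wex-dual perm i₀ max₀) k≤

-- Count along the involution π ↦ π*, then identify the conditions pointwise
-- by dual-WQ.
lemma2p8 : (n : ℕ) → 1 ≤ n → (k j : ℕ) → 1 ≤ k → k ≤ n → 1 ≤ j → j ≤ n →
    countWQ n k j ≡ countWQ n (n + 1 ∸ k) (n + 1 ∸ j)
lemma2p8 (suc n) _ k j _ k≤n _ j≤n = begin
  count (WQ? k j) (perms (suc n))
    ≡⟨ count-involution (WQ? k j) dual (perms-unique (suc n)) dual-involutive dual-∈-perms ⟩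
  count (WQ? k j ∘ dual) (perms (suc n))
    ≡⟨ count-cong (WQ? k j ∘ dual) (WQ? (suc n + 1 ∸ k) (suc n + 1 ∸ j))
         (λ w∈ → dual-WQ (to (∈-perms _) w∈) (≤-trans k≤n (m≤m+n _ 1)) (≤-trans j≤n (m≤m+n _ 1))) ⟩
  count (WQ? (suc n + 1 ∸ k) (suc n + 1 ∸ j)) (perms (suc n))
    ∎
  where
  open ≡-Reasoning
  open Dual n
  WQ? : (k j : ℕ) (w : Word) → Dec (wex w ≡ k × MaxAt w j)
  WQ? k j w = (wex w ≟ k) ×-dec Qdec w j
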